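{- Let $S$ be a polyomino whose rows are $1,\dots,k$ (top to bottom), row $k$ being the bottom row. The following are equivalent: (i) every column of $S$ contains a cell of the bottom row, and $S$ is $\Gamma$-complete; (ii) $S$ is obtained (up to translation) from a Young diagram in French notation with $k$ rows by permuting its top $k-1$ rows; that is, there is a column $c$ and lengths $m_1,\dots,m_k\ge1$ with $m_i\le m_k$ for all $i$ such that row $i$ of $S$ is exactly $\{(i,c),(i,c+1),\dots,(i,c+m_i-1)\}$ for each $i$.
   Context: A polyomino is a finite edge-connected set of unit cells $(i,j)$ of the grid, with row index $i$ increasing from top to bottom and column index $j$ increasing from left to right. A polyomino $S$ is $\Gamma$-complete if for all rows $i<j$ and columns $k<l$: whenever $(j,k),(j,l),(i,l)\in S$, also $(i,k)\in S$. A Young diagram in French notation has left-justified rows whose lengths weakly increase from top to bottom. -}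

module Defs where

open import Data.Nat as ℕ using (ℕ; suc)
open import Data.Integer as ℤ using (ℤ; +_)
open import Data.Product using (_×_; _,_; Σ; ∃; ∃-syntax; proj₁; proj₂)
open import Data.Sum using (_⊎_)
open import Data.List using (List)
open import Data.List.Membership.Propositional using (_∈_)
open import Relation.Binary.PropositionalEquality using (_≡_)
open import Relation.Binary.Construct.Closure.ReflexiveTransitive using (Star)
open import Function.Bundles using (_⇔_)

-- A cell (i , j): row index i (increasing downwards), column index j
-- (increasing to the right). Columns are integers so translations are arbitrary.
Cell : Set
Cell = ℕ × ℤ

-- A finite set of cells, given as a list (duplicates harmless).
CellSet : Set
CellSet = List Cell

Adjacent : Cell → Cell → Set
Adjacent (i , j) (i' , j') =
  (i ≡ i' × (j' ≡ j ℤ.+ + 1 ⊎ j ≡ j' ℤ.+ + 1))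
  ⊎ (j ≡ j' × (i' ≡ suc i ⊎ i ≡ suc i'))

StepIn : CellSet → Cell → Cell → Set
StepIn S a b = a ∈ S × b ∈ S × Adjacent a b

IsPolyomino : CellSet → Set
IsPolyomino S = (∃[ a ] a ∈ S) × (∀ a b → a ∈ S → b ∈ S → Star (StepIn S) a b)

RowsAre : ℕ → CellSet → Set
RowsAre k S =
  (∀ i j → (i , j) ∈ S → 1 ℕ.≤ i × i ℕ.≤ k)
  × (∀ i → 1 ℕ.≤ i → i ℕ.≤ k → ∃[ j ] (i , j) ∈ S)

ΓComplete : CellSet → Set
ΓComplete S = ∀ (i j : ℕ) (k l : ℤ) → i ℕ.< j → k ℤ.< l →
  (j , k) ∈ S → (j , l) ∈ S → (i , l) ∈ S → (i , k) ∈ S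

ColumnsMeetRow : ℕ → CellSet → Set
ColumnsMeetRow k S = ∀ i j → (i , j) ∈ S → (k , j) ∈ S

PermutedYoung : ℕ → CellSet → Set
PermutedYoung k S = Σ ℤ λ c → Σ (ℕ → ℕ) λ m →
  (∀ i → 1 ℕ.≤ i → i ℕ.≤ k → 1 ℕ.≤ m i × m i ℕ.≤ m k)
  × (∀ i → 1 ℕ.≤ i → i ℕ.≤ k → ∀ (j : ℤ) →
       ((i , j) ∈ S) ⇔ (c ℤ.≤ j × j ℤ.< c ℤ.+ + m i))

module Submission where

-- (i) ⇒ (ii). Let c be the least column of S. Connectivity makes the set of
-- occupied columns contiguous (a path moves at most one column per step), so
-- every column between c and a column of S is occupied, and hence, as every
-- column meets the bottom row, the bottom row is full from c onwards. Let
-- r i be the rightmost column of row i. Γ-completeness applied to the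
-- rectangle spanned by (i , r i) and the bottom row fills row i between c and
-- r i, so row i is exactly [c, r i], and (k , r i) ∈ S gives r i ≤ r k.
-- The widths are m i = 1 + (r i - c).

open import Defs
open import Data.Nat as ℕ using (ℕ; suc)
open import Data.Nat.Properties as ℕP using ()
open import Data.Integer as ℤ using (ℤ; +_; +≤+; ∣_∣)
open import Data.Integer.Properties as ℤP using ()
open import Data.Integer.Solver using (module +-*-Solver)
open import Data.Product using (_×_; _,_; ∃-syntax; proj₁; proj₂)
open import Data.Sum using (inj₁; inj₂)
open import Data.List using (List; []; _∷_)
open import Data.List.Relation.Unary.All as All using (All)
open import Data.List.Relation.Unary.Any using (here; there)
open import Data.List.Membership.Propositional using (_∈_)
open import Data.List.Extrema ℤP.≤-totalOrder
  using (max; argmax-sel; xs≤max; ⊥≤max; argmin; argmin-all; f[argmin]≤f[xs])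
open import Relation.Binary.PropositionalEquality
open import Relation.Binary.Construct.Closure.ReflexiveTransitive using (Star; ε; _◅_)
open import Relation.Nullary using (yes; no; contradiction)
open import Function.Base using (id)
open import Function.Bundles using (_⇔_; mk⇔; Equivalence)

open Equivalence using (to; from)

col : Cell → ℤ
col = proj₂

≤⇒<+1 : ∀ {i j : ℤ} → i ℤ.≤ j → i ℤ.< j ℤ.+ + 1
≤⇒<+1 {i} {j} i≤j =
  ℤP.suc[i]≤j⇒i<j (subst (ℤ.suc i ℤ.≤_) (ℤP.+-comm (+ 1) j) (ℤP.suc-mono i≤j))

<+1⇒≤ : ∀ {i j : ℤ} → i ℤ.< j ℤ.+ + 1 → i ℤ.≤ j
<+1⇒≤ {i} {j} i<j+1 = subst (i ℤ.≤_) (ℤP.pred-suc j)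
  (ℤP.i<j⇒i≤pred[j] (subst (i ℤ.<_) (ℤP.+-comm j (+ 1)) i<j+1))

width : ℤ → ℤ → ℕ
width c r = suc ∣ c ℤ.- r ∣

+-width : ∀ {c r} → c ℤ.≤ r → c ℤ.+ + width c r ≡ r ℤ.+ + 1
+-width {c} {r} c≤r = begin
  c ℤ.+ (+ 1 ℤ.+ + ∣ c ℤ.- r ∣)  ≡⟨ cong (λ d → c ℤ.+ (+ 1 ℤ.+ d)) (ℤP.∣-∣-≤ c≤r) ⟩
  c ℤ.+ (+ 1 ℤ.+ (r ℤ.- c))      ≡⟨ shift c r ⟩
  r ℤ.+ + 1                      ∎
  where
  open ≡-Reasoning
  open +-*-Solver
  shift : ∀ c r → c ℤ.+ (+ 1 ℤ.+ (r ℤ.- c)) ≡ r ℤ.+ + 1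
  shift = solve 2 (λ c r → c :+ (con (+ 1) :+ (r :- c)) := r :+ con (+ 1)) refl

width-mono : ∀ {c r r'} → c ℤ.≤ r → r ℤ.≤ r' → width c r ℕ.≤ width c r'
width-mono {c} c≤r r≤r' = ℕ.s≤s (ℤP.drop‿+≤+
  (subst₂ ℤ._≤_ (sym (ℤP.∣-∣-≤ c≤r)) (sym (ℤP.∣-∣-≤ (ℤP.≤-trans c≤r r≤r')))
    (ℤP.+-monoˡ-≤ (ℤ.- c) r≤r')))

max∈ : ∀ {⊥ x xs} → All (⊥ ℤ.≤_) xs → x ∈ xs → max ⊥ xs ∈ xs
max∈ {⊥} {x} {xs} ⊥≤xs x∈xs with argmax-sel id ⊥ xs
... | inj₂ max∈xs = max∈xs
... | inj₁ max≡⊥ = subst (_∈ xs) (ℤP.≤-antisym x≤max max≤x) x∈xs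
  where
  x≤max : x ℤ.≤ max ⊥ xs
  x≤max = All.lookup (xs≤max ⊥ xs) x∈xs
  max≤x : max ⊥ xs ℤ.≤ x
  max≤x = subst (ℤ._≤ x) (sym max≡⊥) (All.lookup ⊥≤xs x∈xs)

rowColumns : ℕ → CellSet → List ℤ
rowColumns i [] = []
rowColumns i ((r , j) ∷ S) with r ℕ.≟ i
... | yes _ = j ∷ rowColumns i S
... | no  _ = rowColumns i S

∈-rowColumns : ∀ i j S → j ∈ rowColumns i S ⇔ (i , j) ∈ S
∈-rowColumns i j S = mk⇔ (sound S) (complete S)
  where
  sound : ∀ S → j ∈ rowColumns i S → (i , j) ∈ S
  sound ((r , j') ∷ S) j∈ with r ℕ.≟ i | j∈
  ... | yes refl | here refl = here refl
  ... | yes refl | there j∈S = there (sound S j∈S)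
  ... | no  _    | j∈S       = there (sound S j∈S)
  complete : ∀ S → (i , j) ∈ S → j ∈ rowColumns i S
  complete ((r , j') ∷ S) ij∈ with r ℕ.≟ i | ij∈
  ... | yes refl | here refl  = here refl
  ... | yes refl | there ij∈S = there (complete S ij∈S)
  ... | no  i≢i  | here refl  = contradiction refl i≢i
  ... | no  _    | there ij∈S = complete S ij∈S

-- An edge step moves at most one column to the right; this bounds how far a
-- path can jump past a column.
adjacent-col≤ : ∀ {a b} → Adjacent a b → col b ℤ.≤ col a ℤ.+ + 1
adjacent-col≤ (inj₁ (_ , inj₁ refl)) = ℤP.≤-refl
adjacent-col≤ {b = _ , j'} (inj₁ (_ , inj₂ refl)) =
  ℤP.≤-trans (ℤP.i≤i+j j' (+ 1)) (ℤP.i≤i+j (j' ℤ.+ + 1) (+ 1))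
adjacent-col≤ {_ , j} (inj₂ (refl , _)) = ℤP.i≤i+j j (+ 1)

columnsContiguous : ∀ {S a b} → a ∈ S → Star (StepIn S) a b →
  ∀ t → col a ℤ.≤ t → t ℤ.≤ col b → ∃[ r ] (r , t) ∈ S
columnsContiguous {S} {r , j} a∈S ε t j≤t t≤j =
  r , subst (λ u → (r , u) ∈ S) (ℤP.≤-antisym j≤t t≤j) a∈S
columnsContiguous {S} {r , j} a∈S (_◅_ {j = a'} (_ , a'∈S , adj) path) t j≤t t≤b
  with col a' ℤP.≤? t
... | yes a'≤t = columnsContiguous a'∈S path t a'≤t t≤b
... | no  a'≰t = r , subst (λ u → (r , u) ∈ S) (ℤP.≤-antisym j≤t t≤j) a∈S
  where
  t≤j : t ℤ.≤ j
  t≤j = <+1⇒≤ (ℤP.<-≤-trans (ℤP.≰⇒> a'≰t) (adjacent-col≤ adj))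

ΓComplete-≤ : ∀ {S i k t r} → ΓComplete S → i ℕ.≤ k → t ℤ.≤ r →
  (k , t) ∈ S → (k , r) ∈ S → (i , r) ∈ S → (i , t) ∈ S
ΓComplete-≤ {i = i} {k} {t} {r} Γ i≤k t≤r kt kr ir with i ℕ.≟ k | t ℤ.≟ r
... | yes refl | _        = kt
... | no  _    | yes refl = ir
... | no  i≢k  | no  t≢r  = Γ i k t r (ℕP.≤∧≢⇒< i≤k i≢k) (ℤP.≤∧≢⇒< t≤r t≢r) kt kr ir

-- (ii) ⇒ (i): in a permuted Young diagram every row starts at column c and
-- the bottom row is the longest.

young⇒columnsMeetRow : ∀ {k S} → RowsAre k S → PermutedYoung k S → ColumnsMeetRow k S
young⇒columnsMeetRow (rowsIn , _) (c , _ , m≤m[k] , row) i j ij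
  with rowsIn i j ij
... | 1≤i , i≤k with to (row i 1≤i i≤k j) ij
...   | c≤j , j<c+m[i] = from (row _ (ℕP.≤-trans 1≤i i≤k) ℕP.≤-refl j)
  (c≤j , ℤP.<-≤-trans j<c+m[i] (ℤP.+-monoʳ-≤ c (+≤+ (proj₂ (m≤m[k] i 1≤i i≤k)))))

young⇒ΓComplete : ∀ {k S} → RowsAre k S → PermutedYoung k S → ΓComplete S
young⇒ΓComplete (rowsIn , _) (_ , _ , _ , row) i j t r _ t<r jt _ ir
  with rowsIn i r ir | rowsIn j t jt
... | 1≤i , i≤k | 1≤j , j≤k = from (row i 1≤i i≤k t)
  (proj₁ (to (row j 1≤j j≤k t) jt) , ℤP.<-trans t<r (proj₂ (to (row i 1≤i i≤k r) ir)))

module YoungShape (k : ℕ) (S : CellSet) {a₀ : Cell} (a₀∈S : a₀ ∈ S)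
  (connected : ∀ a b → a ∈ S → b ∈ S → Star (StepIn S) a b)
  (meetsBottom : ColumnsMeetRow k S) (Γ : ΓComplete S) where

  leftmost : Cell
  leftmost = argmin col a₀ S

  leftmost∈S : leftmost ∈ S
  leftmost∈S = argmin-all col a₀∈S (All.tabulate id)

  c : ℤ
  c = col leftmost

  c≤col : ∀ {x} → x ∈ S → c ℤ.≤ col x
  c≤col x∈S = All.lookup (f[argmin]≤f[xs] a₀ S) x∈S

  bottomRowFull : ∀ {x} → x ∈ S → ∀ t → c ℤ.≤ t → t ℤ.≤ col x → (k , t) ∈ S
  bottomRowFull x∈S t c≤t t≤x with columnsContiguous leftmost∈S (connected _ _ leftmost∈S x∈S) t c≤t t≤x
  ... | r , rt∈S = meetsBottom r t rt∈S

  -- The rightmost column of row i (c if the row is empty).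
  rightEnd : ℕ → ℤ
  rightEnd i = max c (rowColumns i S)

  c≤rightEnd : ∀ i → c ℤ.≤ rightEnd i
  c≤rightEnd i = ⊥≤max c (rowColumns i S)

  ≤rightEnd : ∀ {i j} → (i , j) ∈ S → j ℤ.≤ rightEnd i
  ≤rightEnd {i} {j} ij = All.lookup (xs≤max c _) (from (∈-rowColumns i j S) ij)

  rightEnd∈S : ∀ {i j} → (i , j) ∈ S → (i , rightEnd i) ∈ S
  rightEnd∈S {i} {j} ij = to (∈-rowColumns i _ S) (max∈ c≤row (from (∈-rowColumns i j S) ij))
    where
    c≤row : All (c ℤ.≤_) (rowColumns i S)
    c≤row = All.tabulate (λ {j'} j'∈ → c≤col (to (∈-rowColumns i j' S) j'∈))

  -- A nonempty row i ≤ k is exactly the interval [c, rightEnd i]: Γ-completeness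
  -- fills it from its rightmost cell and the full bottom row.
  row≡interval : ∀ {i j₀} → i ℕ.≤ k → (i , j₀) ∈ S →
    ∀ j → (i , j) ∈ S ⇔ (c ℤ.≤ j × j ℤ.≤ rightEnd i)
  row≡interval {i} i≤k ij₀ j = mk⇔ (λ ij → c≤col ij , ≤rightEnd ij) fill
    where
    ir : (i , rightEnd i) ∈ S
    ir = rightEnd∈S ij₀
    fill : c ℤ.≤ j × j ℤ.≤ rightEnd i → (i , j) ∈ S
    fill (c≤j , j≤r) = ΓComplete-≤ Γ i≤k j≤r (bottomRowFull ir j c≤j j≤r) (meetsBottom i _ ir) ir

  m : ℕ → ℕ
  m i = width c (rightEnd i)

  m≤m[k] : ∀ {i j₀} → (i , j₀) ∈ S → m i ℕ.≤ m k
  m≤m[k] ij₀ = width-mono (c≤rightEnd _) (≤rightEnd (meetsBottom _ _ (rightEnd∈S ij₀)))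

  permutedYoung : (∀ i → 1 ℕ.≤ i → i ℕ.≤ k → ∃[ j ] (i , j) ∈ S) → PermutedYoung k S
  permutedYoung rowsNonempty = c , m , lengths , rows
    where
    lengths : ∀ i → 1 ℕ.≤ i → i ℕ.≤ k → 1 ℕ.≤ m i × m i ℕ.≤ m k
    lengths i 1≤i i≤k = ℕ.s≤s ℕ.z≤n , m≤m[k] (proj₂ (rowsNonempty i 1≤i i≤k))
    rows : ∀ i → 1 ℕ.≤ i → i ℕ.≤ k → ∀ j → (i , j) ∈ S ⇔ (c ℤ.≤ j × j ℤ.< c ℤ.+ + m i)
    rows i 1≤i i≤k j = mk⇔
      (λ ij → let (c≤j , j≤r) = to interval ij in c≤j , subst (j ℤ.<_) (sym c+m) (≤⇒<+1 j≤r))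
      (λ (c≤j , j<c+m) → from interval (c≤j , <+1⇒≤ (subst (j ℤ.<_) c+m j<c+m)))
      where
      interval : (i , j) ∈ S ⇔ (c ℤ.≤ j × j ℤ.≤ rightEnd i)
      interval = row≡interval i≤k (proj₂ (rowsNonempty i 1≤i i≤k)) j
      c+m : c ℤ.+ + m i ≡ rightEnd i ℤ.+ + 1
      c+m = +-width (c≤rightEnd i)

lemma4p5 : (k : ℕ) (S : CellSet) → IsPolyomino S → RowsAre k S →
    ((ColumnsMeetRow k S × ΓComplete S) ⇔ PermutedYoung k S)
lemma4p5 k S ((_ , a₀∈S) , connected) rowsAre = mk⇔
  (λ (meetsBottom , Γ) →
    YoungShape.permutedYoung k S a₀∈S connected meetsBottom Γ (proj₂ rowsAre))
  (λ young → young⇒columnsMeetRow rowsAre young , young⇒ΓComplete rowsAre young)
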